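{- Assume Hypothesis H (described in the context) holds, and let $p$ be a prime dividing $|G|$ such that $p$ does not divide $\lambda$. Suppose a nontrivial $p$-subgroup $P$ of $G$ fixes at least two distinct points $\alpha,\beta$, and let $\Delta\in\mathcal{C}$ with $\alpha\in\Delta$. (a) Then $P$ fixes (setwise) at least one block $B$ containing $\{\alpha,\beta\}$, and hence leaves invariant the $\ell$-subset $B\cap\Delta$ of $\Delta$ and the $(k/\ell)$-subset $\mathcal{C}(B):=\{\Delta'\in\mathcal{C}\mid B\cap\Delta'\neq\emptyset\}$ of $\mathcal{C}$. (b) Moreover, if $p>\lambda$ then $P$ fixes setwise each block containing $\{\alpha,\beta\}$.
   Context: A $2$-$(v,k,\lambda)$ design $\mathcal{D}=(\mathcal{P},\mathcal{B})$: $\mathcal{P}$ is a set of $v$ points, $\mathcal{B}$ a set of $b$ blocks, each a $k$-subset of $\mathcal{P}$, each pair of distinct points lying in exactly $\lambda$ blocks, with $2<k<v$; $r$ is the number of blocks containing a given point. Automorphisms are permutations of $\mathcal{P}$ preserving $\mathcal{B}$; a flag is a pair $(\alpha,B)$ with $\alpha\in B\in\mathcal{B}$. Hypothesis H: (a) $\mathcal{D}$ is such a design; (b) $G$ is a group of automorphisms of $\mathcal{D}$ transitive on flags, leaving invariant a partition $\mathcal{C}=\{\Delta_1,\dots,\Delta_d\}$ of $\mathcal{P}$ with $d\geq 2$ classes each of size $c\geq 2$; $D=G^{\mathcal{C}}$ is the permutation group induced by $G$ on $\mathcal{C}$, $L=(G_\Delta)^\Delta$ is the permutation group induced on a class $\Delta\in\mathcal{C}$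 by its setwise stabiliser $G_\Delta$, $G$ is regarded as a subgroup of $L\wr D$, and $K=G_{(\mathcal{C})}$ is the kernel of the action of $G$ on $\mathcal{C}$; (c) for every block $B$ and class $\Delta$ with $B\cap\Delta\neq\emptyset$ the size $\ell=|B\cap\Delta|$ is independent of $B,\Delta$, and $\ell\geq 2$. -}

module Defs where

open import Data.Nat using (ℕ; suc; _<_; _≤_; _^_)
open import Data.Bool using (Bool)
open import Data.Fin using (Fin)
open import Data.Fin.Properties using (_≟_; any?)
open import Data.Fin.Subset using (Subset; _∈_; _∩_; ∣_∣)
open import Data.Fin.Subset.Properties using (_∈?_)
open import Data.Vec using (Vec; lookup; tabulate; allFin)
open import Data.List using (List; length; filter)
open import Data.List.Membership.Propositional using () renaming (_∈_ to _∈ₗ_)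
open import Data.List.Relation.Unary.All using (All)
open import Data.List.Relation.Unary.Unique.Propositional using (Unique)
open import Data.Product using (Σ; ∃; _×_; _,_)
open import Relation.Nullary using (¬_)
open import Relation.Nullary.Decidable using (⌊_⌋; _×-dec_)
open import Relation.Binary.PropositionalEquality using (_≡_; _≢_)
open import Function.Definitions using (Injective)
open import Function.Bundles using (_⇔_)

-- Points are Fin v.  A block is a subset of the points (Subset v).
-- A permutation of Fin v is stored as the vector of its values
-- (so equality of permutations is propositional equality).

Perm : ℕ → Set
Perm v = Vec (Fin v) v

_·_ : ∀ {v} → Perm v → Fin v → Fin v
g · x = lookup g x

IsPerm : ∀ {v} → Perm v → Set
IsPerm {v} g = Injective _≡_ _≡_ (lookup g)   -- injective on Fin v, hence bijective

idPerm : ∀ {v} → Perm v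
idPerm {v} = allFin v

_∘ₚ_ : ∀ {v} → Perm v → Perm v → Perm v
g ∘ₚ h = tabulate (λ x → g · (h · x))

MapsTo : ∀ {v} → Perm v → Subset v → Subset v → Set
MapsTo g B B' = ∀ x → (x ∈ B) ⇔ (g · x ∈ B')

FixesSet : ∀ {v} → Perm v → Subset v → Set
FixesSet g B = MapsTo g B B

-- Finite groups of permutations, given by the (duplicate-free) list of
-- their elements; |G| = length of the list.

record PermGroup (v : ℕ) (G : List (Perm v)) : Set where
  field
    unique   : Unique G
    perms    : All IsPerm G
    hasId    : idPerm ∈ₗ G
    closed   : ∀ {g h} → g ∈ₗ G → h ∈ₗ G → (g ∘ₚ h) ∈ₗ G
    -- (a finite set of permutations containing 1 and closed under
    --  composition is a group)

record Subgroup (v : ℕ) (P G : List (Perm v)) : Set where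
  field
    isGroup  : PermGroup v P
    subset   : ∀ {g} → g ∈ₗ P → g ∈ₗ G

NontrivialPSubgroup : ∀ {v} → ℕ → List (Perm v) → List (Perm v) → Set
NontrivialPSubgroup {v} p P G =
  Subgroup v P G × Σ ℕ (λ n → length P ≡ p ^ suc n)

pairCount : ∀ {v} → List (Subset v) → Fin v → Fin v → ℕ
pairCount blocks x y = length (filter (λ B → (x ∈? B) ×-dec (y ∈? B)) blocks)

record Design (v k lam : ℕ) (blocks : List (Subset v)) : Set where
  field
    unique     : Unique blocks
    blockSize  : ∀ {B} → B ∈ₗ blocks → ∣ B ∣ ≡ k
    balanced   : ∀ x y → x ≢ y → pairCount blocks x y ≡ lam
    2<k        : 2 < k
    k<v        : k < v

IsAutomorphism : ∀ {v} → List (Subset v) → Perm v → Set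
IsAutomorphism blocks g =
  IsPerm g × (∀ {B} → B ∈ₗ blocks → Σ (Subset _) λ B' → B' ∈ₗ blocks × MapsTo g B B')

FlagTransitive : ∀ {v} → List (Subset v) → List (Perm v) → Set
FlagTransitive blocks G =
  ∀ {α α' B B'} → B ∈ₗ blocks → α ∈ B → B' ∈ₗ blocks → α' ∈ B' →
  Σ _ λ g → g ∈ₗ G × g · α ≡ α' × MapsTo g B B'

-- Partitions of the points into d classes Δ_0,…,Δ_{d-1}, given by the
-- class-assignment map cls : Fin v → Fin d.

classSet : ∀ {v d} → (Fin v → Fin d) → Fin d → Subset v
classSet cls i = tabulate (λ x → ⌊ cls x ≟ i ⌋)

classesMeeting : ∀ {v d} → (Fin v → Fin d) → Subset v → Subset d
classesMeeting {v} cls B = tabulate (λ i → ⌊ any? (λ x → (x ∈? B) ×-dec (cls x ≟ i)) ⌋)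

ClassesOfSize : ∀ {v d} → (Fin v → Fin d) → ℕ → Set
ClassesOfSize {d = d} cls c = ∀ (i : Fin d) → ∣ classSet cls i ∣ ≡ c

PreservesPartition : ∀ {v d} → (Fin v → Fin d) → List (Perm v) → Set
PreservesPartition cls G =
  ∀ {g} → g ∈ₗ G → ∀ x y → cls x ≡ cls y → cls (g · x) ≡ cls (g · y)

FixesClassSet : ∀ {v d} → (Fin v → Fin d) → Perm v → Subset d → Set
FixesClassSet cls g S = ∀ x → (cls x ∈ S) ⇔ (cls (g · x) ∈ S)

record HypothesisH (v k lam d c ℓ : ℕ) (blocks : List (Subset v))
                   (G : List (Perm v)) (cls : Fin v → Fin d) : Set where
  field
    design        : Design v k lam blocks
    group         : PermGroup v G
    automorphisms : All (IsAutomorphism blocks) G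
    flagTrans     : FlagTransitive blocks G
    invariant     : PreservesPartition cls G
    2≤d           : 2 ≤ d
    2≤c           : 2 ≤ c
    classSize     : ClassesOfSize cls c
    2≤ℓ           : 2 ≤ ℓ
    constMeet     : ∀ {B} → B ∈ₗ blocks → ∀ (i : Fin d) →
                    ¬ (∣ B ∩ classSet cls i ∣ ≡ 0) → ∣ B ∩ classSet cls i ∣ ≡ ℓ

{-# OPTIONS --safe #-}
-- P acts on the list of the λ blocks through α and β (on the right, by
-- preimages).  By orbit–stabiliser every orbit of the p-group P has p-power
-- length, so the orbits of length 1 (the blocks fixed by P) account for λ
-- modulo p: there is one when p ∤ λ, and when λ < p every orbit is a single
-- block.  If P fixes a block B, it also fixes B ∩ Δ (it fixes α, hence its
-- class Δ) and the set 𝒞(B) of classes meeting B; 𝒞(B) has k/ℓ elements since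
-- B meets each of them in exactly ℓ points.
module Submission where

open import Defs
open import Data.Nat using (ℕ; zero; suc; _+_; _*_; _≤_; _<_; _^_; z≤n; s≤s)
open import Data.Nat.Properties
  using (≤-trans; ≤-<-trans; ≤-reflexive; ≤-antisym; +-suc; *-comm; <-irrefl; 1+n≰n; +-0-commutativeMonoid)
open import Data.Nat.Divisibility using (_∣_; _∣?_; divides; _∣0; ∣1⇒≡1; ∣m∣n⇒∣m+n; ∣⇒≤)
open import Data.Nat.Coprimality using (Coprime; coprime-divisor)
open import Data.Nat.Primality using (Prime; prime⇒irreducible)
open import Data.Nat.Induction using (<-wellFounded)
open import Induction.WellFounded using (Acc; acc)
open import Algebra.Properties.CommutativeMonoid.Sum +-0-commutativeMonoid
  using (sum; sum-syntax; sum-cong-≗; sum-replicate-zero; ∑-distrib-+)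
open import Data.Bool using (true; false)
import Data.Bool.Properties as Bool
open import Data.Fin using (Fin; zero; suc)
open import Data.Fin.Properties using (_≟_; any?)
open import Data.Fin.Subset using (Subset; _∈_; _∉_; _⊆_; _∩_; ∣_∣; ⁅_⁆)
open import Data.Fin.Subset.Properties
  using ( _∈?_; drop-there; ⊆-antisym; x∈p∩q⁺; x∈p∩q⁻; ∣⊥∣≡0; Empty-unique
        ; p⊆q⇒∣p∣≤∣q∣; ∣⁅x⁆∣≡1; x∈⁅y⁆⇒x≡y)
open import Data.Vec using ([]; _∷_; here; there; tabulate)
open import Data.Vec.Properties
  using (lookup∘tabulate; tabulate∘lookup; tabulate-cong; lookup-allFin; []=⇒lookup; lookup⇒[]=; ≡-dec)
open import Data.List using (List; []; _∷_; length; filter; map)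
open import Data.List.Properties using (length-map; length-filter; filter-notAll; filter-reject)
open import Data.List.Membership.Propositional using (find) renaming (_∈_ to _∈ₗ_)
open import Data.List.Membership.Propositional.Properties using (∈-filter⁺; ∈-filter⁻; ∈-map⁻)
open import Data.List.Relation.Unary.Any using (Any; here; there)
import Data.List.Relation.Unary.Any as Any
import Data.List.Relation.Unary.All as All
open import Data.List.Relation.Unary.AllPairs using ([]; _∷_)
open import Data.List.Relation.Unary.Unique.Propositional using (Unique)
import Data.List.Relation.Unary.Unique.Propositional.Properties as Unique
open import Data.Product using (∃-syntax; Σ; _×_; _,_; proj₁; proj₂)
open import Data.Sum using (inj₁; inj₂)
open import Function using (_∘_)
open import Function.Bundles using (_⇔_; mk⇔; Equivalence)
open Equivalence using (to; from)
open import Relation.Nullary using (¬_; Dec; yes; no; contradiction; _×-dec_)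
open import Relation.Nullary.Decidable using (⌊_⌋; ⌊⌋-map′; toWitness; fromWitness)
open import Relation.Unary using (Pred; Decidable)
open import Relation.Unary.Properties using (∁?)
open import Relation.Binary.Definitions using (DecidableEquality)
open import Relation.Binary.PropositionalEquality
  using (_≡_; _≢_; refl; sym; trans; cong; cong₂; subst; subst₂; module ≡-Reasoning)
open ≡-Reasoning

module _ {A : Set} where

  length-filter+length-filter-∁ : ∀ {p} {P : Pred A p} (P? : Decidable P) xs →
    length xs ≡ length (filter P? xs) + length (filter (∁? P?) xs)
  length-filter+length-filter-∁ P? [] = refl
  length-filter+length-filter-∁ P? (x ∷ xs) with P? x
  ... | yes _ = cong suc (length-filter+length-filter-∁ P? xs)
  ... | no _  = trans (cong suc (length-filter+length-filter-∁ P? xs)) (sym (+-suc _ _))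

  filter-filter-⇒ : ∀ {p q} {P : Pred A p} {Q : Pred A q} (P? : Decidable P) (Q? : Decidable Q) →
    (∀ {x} → P x → Q x) → ∀ xs → filter P? (filter Q? xs) ≡ filter P? xs
  filter-filter-⇒ P? Q? P⇒Q [] = refl
  filter-filter-⇒ P? Q? P⇒Q (x ∷ xs) with Q? x
  ... | no ¬q = trans (filter-filter-⇒ P? Q? P⇒Q xs) (sym (filter-reject P? (¬q ∘ P⇒Q)))
  ... | yes _ with P? x
  ...   | yes _ = cong (x ∷_) (filter-filter-⇒ P? Q? P⇒Q xs)
  ...   | no _  = filter-filter-⇒ P? Q? P⇒Q xs

  length≡1⇒≡ : ∀ {xs : List A} → length xs ≡ 1 → ∀ {a b} → a ∈ₗ xs → b ∈ₗ xs → a ≡ b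
  length≡1⇒≡ {_ ∷ []} _ (here refl) (here refl) = refl

  module _ (_≟_ : DecidableEquality A) where

    open import Data.List.Membership.DecPropositional _≟_ using () renaming (_∈?_ to _∈ₗ?_)

    Unique-⊆⇒length≤ : ∀ {xs ys : List A} → Unique xs → (∀ {z} → z ∈ₗ xs → z ∈ₗ ys) →
      length xs ≤ length ys
    Unique-⊆⇒length≤ {[]} _ _ = z≤n
    Unique-⊆⇒length≤ {x ∷ xs} {ys} (x∉xs ∷ xs!) xs⊆ys =
      ≤-trans (s≤s (Unique-⊆⇒length≤ xs! xs⊆ys-x)) (filter-notAll (∁? (_≟ x)) ys x∈ys)
      where
      xs⊆ys-x : ∀ {z} → z ∈ₗ xs → z ∈ₗ filter (∁? (_≟ x)) ys
      xs⊆ys-x z∈xs = ∈-filter⁺ (∁? (_≟ x)) (xs⊆ys (there z∈xs)) (λ z≡x → All.lookup x∉xs z∈xs (sym z≡x))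
      x∈ys : Any (λ z → ¬ z ≢ x) ys
      x∈ys = Any.map (λ { refl ¬x≢x → ¬x≢x refl }) (xs⊆ys (here refl))

    Unique-⊆∧length≥⇒⊇ : ∀ {xs ys : List A} → Unique xs → (∀ {z} → z ∈ₗ xs → z ∈ₗ ys) →
      length ys ≤ length xs → ∀ {z} → z ∈ₗ ys → z ∈ₗ xs
    Unique-⊆∧length≥⇒⊇ {xs} {ys} xs! xs⊆ys ys≤xs {z} z∈ys with z ∈ₗ? xs
    ... | yes z∈xs = z∈xs
    ... | no z∉xs  = contradiction (≤-trans (Unique-⊆⇒length≤ z∷xs! z∷xs⊆ys) ys≤xs) (<-irrefl refl)
      where
      z∷xs! : Unique (z ∷ xs)
      z∷xs! = All.tabulate (λ x∈xs z≡x → z∉xs (Any.map (trans z≡x) x∈xs)) ∷ xs!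
      z∷xs⊆ys : ∀ {x} → x ∈ₗ z ∷ xs → x ∈ₗ ys
      z∷xs⊆ys (here refl) = z∈ys
      z∷xs⊆ys (there x∈xs) = xs⊆ys x∈xs

module _ {A B : Set} (_≟_ : DecidableEquality B) (f : A → B) where

  fibre : B → List A → List A
  fibre y = filter (λ x → f x ≟ y)

  length-by-fibres : ∀ s {ys : List B} → Unique ys → ∀ xs →
    (∀ {x} → x ∈ₗ xs → f x ∈ₗ ys) → (∀ {y} → y ∈ₗ ys → length (fibre y xs) ≡ s) →
    length xs ≡ length ys * s
  length-by-fibres s [] [] _ _ = refl
  length-by-fibres s [] (x ∷ xs) f[xs]⊆[] _ with () ← f[xs]⊆[] (here refl)
  length-by-fibres s {y ∷ ys} (y∉ys ∷ ys!) xs f[xs]⊆ys fibres = begin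
    length xs                             ≡⟨ length-filter+length-filter-∁ (λ x → f x ≟ y) xs ⟩
    length (fibre y xs) + length rest     ≡⟨ cong₂ _+_ (fibres (here refl)) rest≡ys*s ⟩
    s + length ys * s                     ∎
    where
    rest : List A
    rest = filter (∁? (λ x → f x ≟ y)) xs
    f[rest]⊆ys : ∀ {x} → x ∈ₗ rest → f x ∈ₗ ys
    f[rest]⊆ys x∈rest with ∈-filter⁻ (∁? (λ x → f x ≟ y)) x∈rest
    ... | x∈xs , fx≢y with f[xs]⊆ys x∈xs
    ...   | here fx≡y = contradiction fx≡y fx≢y
    ...   | there fx∈ys = fx∈ys
    rest-fibres : ∀ {z} → z ∈ₗ ys → length (fibre z rest) ≡ s
    rest-fibres {z} z∈ys = trans
      (cong length (filter-filter-⇒ (λ x → f x ≟ z) (∁? (λ x → f x ≟ y)) fx≡z⇒fx≢y xs))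
      (fibres (there z∈ys))
      where
      fx≡z⇒fx≢y : ∀ {x} → f x ≡ z → f x ≢ y
      fx≡z⇒fx≢y refl fx≡y = All.lookup y∉ys z∈ys (sym fx≡y)
    rest≡ys*s : length rest ≡ length ys * s
    rest≡ys*s = length-by-fibres s ys! rest f[rest]⊆ys rest-fibres

module _ {v : ℕ} where

  _≟ₚ_ : DecidableEquality (Perm v)
  _≟ₚ_ = ≡-dec _≟_

  Perm-ext : ∀ {g h : Perm v} → (∀ x → g · x ≡ h · x) → g ≡ h
  Perm-ext {g} {h} g≗h = begin
    g                      ≡⟨ tabulate∘lookup g ⟨
    tabulate (g ·_)        ≡⟨ tabulate-cong g≗h ⟩
    tabulate (h ·_)        ≡⟨ tabulate∘lookup h ⟩
    h                      ∎

  ∘ₚ-· : ∀ (g h : Perm v) x → (g ∘ₚ h) · x ≡ g · (h · x)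
  ∘ₚ-· g h = lookup∘tabulate _

  idPerm-· : ∀ (x : Fin v) → idPerm · x ≡ x
  idPerm-· = lookup-allFin

  ∘ₚ≡idPerm⇒· : ∀ (g h : Perm v) → g ∘ₚ h ≡ idPerm → ∀ x → g · (h · x) ≡ x
  ∘ₚ≡idPerm⇒· g h gh≡1 x = trans (sym (∘ₚ-· g h x)) (trans (cong (_· x) gh≡1) (idPerm-· x))

  ∘ₚ-cancelˡ : ∀ {g : Perm v} → IsPerm g → ∀ {h h'} → g ∘ₚ h ≡ g ∘ₚ h' → h ≡ h'
  ∘ₚ-cancelˡ {g} g-inj {h} {h'} gh≡gh' = Perm-ext λ x →
    g-inj (trans (sym (∘ₚ-· g h x)) (trans (cong (_· x) gh≡gh') (∘ₚ-· g h' x)))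

  ∘ₚ-cancelʳ : ∀ {g g⁻¹ : Perm v} → g ∘ₚ g⁻¹ ≡ idPerm → ∀ {h h'} → h ∘ₚ g ≡ h' ∘ₚ g → h ≡ h'
  ∘ₚ-cancelʳ {g} {g⁻¹} gg⁻¹≡1 {h} {h'} hg≡h'g = Perm-ext λ x → begin
    h · x                  ≡⟨ cong (h ·_) (∘ₚ≡idPerm⇒· g g⁻¹ gg⁻¹≡1 x) ⟨
    h · (g · (g⁻¹ · x))    ≡⟨ ∘ₚ-· h g _ ⟨
    (h ∘ₚ g) · (g⁻¹ · x)   ≡⟨ cong (_· (g⁻¹ · x)) hg≡h'g ⟩
    (h' ∘ₚ g) · (g⁻¹ · x)  ≡⟨ ∘ₚ-· h' g _ ⟩
    h' · (g · (g⁻¹ · x))   ≡⟨ cong (h' ·_) (∘ₚ≡idPerm⇒· g g⁻¹ gg⁻¹≡1 x) ⟩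
    h' · x                 ∎

module _ {v : ℕ} {G : List (Perm v)} (G-group : PermGroup v G) where

  open PermGroup G-group

  -- Left multiplication by g permutes the finite list G, so it hits idPerm.
  inverse : ∀ {g} → g ∈ₗ G → ∃[ g⁻¹ ] g⁻¹ ∈ₗ G × g ∘ₚ g⁻¹ ≡ idPerm × g⁻¹ ∘ₚ g ≡ idPerm
  inverse {g} g∈G
    with ∈-map⁻ (g ∘ₚ_) (Unique-⊆∧length≥⇒⊇ _≟ₚ_ gG! gG⊆G (≤-reflexive (sym (length-map (g ∘ₚ_) G))) hasId)
    where
    g-inj : IsPerm g
    g-inj = All.lookup perms g∈G
    gG! : Unique (map (g ∘ₚ_) G)
    gG! = Unique.map⁺ (∘ₚ-cancelˡ {g = g} g-inj) unique
    gG⊆G : ∀ {z} → z ∈ₗ map (g ∘ₚ_) G → z ∈ₗ G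
    gG⊆G z∈gG with ∈-map⁻ (g ∘ₚ_) z∈gG
    ... | h , h∈G , refl = closed g∈G h∈G
  ... | g⁻¹ , g⁻¹∈G , 1≡gg⁻¹ = g⁻¹ , g⁻¹∈G , sym 1≡gg⁻¹ ,
        Perm-ext (λ x → trans (∘ₚ-· g⁻¹ g x)
          (trans (All.lookup perms g∈G (∘ₚ≡idPerm⇒· g g⁻¹ (sym 1≡gg⁻¹) (g · x))) (sym (idPerm-· x))))

module _ {n : ℕ} where

  ∈-tabulate⇔ : ∀ {p} {P : Pred (Fin n) p} (P? : Decidable P) {i} → i ∈ tabulate (λ j → ⌊ P? j ⌋) ⇔ P i
  ∈-tabulate⇔ P? {i} = mk⇔
    (λ i∈ → toWitness (from Bool.T-≡ (trans (sym (lookup∘tabulate _ i)) ([]=⇒lookup i∈))))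
    (λ Pi → lookup⇒[]= i _ (trans (lookup∘tabulate _ i) (to Bool.T-≡ (fromWitness Pi))))

  Subset-ext : ∀ {p q : Subset n} → (∀ x → x ∈ p ⇔ x ∈ q) → p ≡ q
  Subset-ext p≐q = ⊆-antisym (λ {x} → to (p≐q x)) (λ {x} → from (p≐q x))

FixesSet-∩ : ∀ {v} {g : Perm v} {A B} → FixesSet g A → FixesSet g B → FixesSet g (A ∩ B)
FixesSet-∩ {A = A} {B} g[A]≡A g[B]≡B x = mk⇔
  (λ x∈A∩B → let x∈A , x∈B = x∈p∩q⁻ A B x∈A∩B in
     x∈p∩q⁺ (to (g[A]≡A x) x∈A , to (g[B]≡B x) x∈B))
  (λ gx∈A∩B → let gx∈A , gx∈B = x∈p∩q⁻ A B gx∈A∩B in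
     x∈p∩q⁺ (from (g[A]≡A x) gx∈A , from (g[B]≡B x) gx∈B))

x∈p⇒∣p∣≢0 : ∀ {n} {x : Fin n} {p : Subset n} → x ∈ p → ∣ p ∣ ≢ 0
x∈p⇒∣p∣≢0 {x = x} {p} x∈p ∣p∣≡0 = 1+n≰n (subst₂ _≤_ (∣⁅x⁆∣≡1 x) ∣p∣≡0 (p⊆q⇒∣p∣≤∣q∣ ⁅x⁆⊆p))
  where
  ⁅x⁆⊆p : ⁅ x ⁆ ⊆ p
  ⁅x⁆⊆p y∈⁅x⁆ = subst (_∈ p) (sym (x∈⁅y⁆⇒x≡y x y∈⁅x⁆)) x∈p

-- ∣ b ∷ [] ∣ serves as the Iverson bracket of a Boolean b.
∣x∷p∣≡∣x∷[]∣+∣p∣ : ∀ {n} x (p : Subset n) → ∣ x ∷ p ∣ ≡ ∣ x ∷ [] ∣ + ∣ p ∣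
∣x∷p∣≡∣x∷[]∣+∣p∣ true  p = refl
∣x∷p∣≡∣x∷[]∣+∣p∣ false p = refl

∑-indicator : ∀ {d} (j : Fin d) → ∑[ i < d ] ∣ ⌊ j ≟ i ⌋ ∷ [] ∣ ≡ 1
∑-indicator {suc d} zero    = cong suc (sum-replicate-zero d)
∑-indicator {suc d} (suc j) =
  trans (sum-cong-≗ λ i → cong (λ b → ∣ b ∷ [] ∣) (⌊⌋-map′ _ _ (j ≟ i))) (∑-indicator j)

∑-constOn : ∀ {d} (S : Subset d) (f : Fin d → ℕ) {ℓ} →
  (∀ {i} → i ∈ S → f i ≡ ℓ) → (∀ {i} → i ∉ S → f i ≡ 0) → sum f ≡ ∣ S ∣ * ℓ
∑-constOn []          f on off = refl
∑-constOn (true ∷ S)  f on off =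
  cong₂ _+_ (on here) (∑-constOn S (f ∘ suc) (on ∘ there) (off ∘ (_∘ drop-there)))
∑-constOn (false ∷ S) f on off =
  cong₂ _+_ (off λ ()) (∑-constOn S (f ∘ suc) (on ∘ there) (off ∘ (_∘ drop-there)))

∣p∣≡∑∣p∩classSet∣ : ∀ {v d} (cls : Fin v → Fin d) B → ∣ B ∣ ≡ ∑[ i < d ] ∣ B ∩ classSet cls i ∣
∣p∣≡∑∣p∩classSet∣ {d = d} cls []          = sym (sum-replicate-zero d)
∣p∣≡∑∣p∩classSet∣         cls (false ∷ B) = ∣p∣≡∑∣p∩classSet∣ (λ x → cls (suc x)) B
∣p∣≡∑∣p∩classSet∣ {d = d} cls (true ∷ B)  = begin
  suc ∣ B ∣                                      ≡⟨ cong₂ _+_ (∑-indicator (cls zero)) (sym IH) ⟨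
  ∑[ i < d ] [cls0≡ i ] + ∑[ i < d ] ∣B∩Δ′ i ∣    ≡⟨ ∑-distrib-+ [cls0≡_] ∣B∩Δ′_∣ ⟨
  ∑[ i < d ] ([cls0≡ i ] + ∣B∩Δ′ i ∣)             ≡⟨ sum-cong-≗ {d} split ⟨
  ∑[ i < d ] ∣ (true ∷ B) ∩ classSet cls i ∣     ∎
  where
  cls′ : Fin _ → Fin d
  cls′ x = cls (suc x)
  IH : ∣ B ∣ ≡ ∑[ i < d ] ∣ B ∩ classSet cls′ i ∣
  IH = ∣p∣≡∑∣p∩classSet∣ cls′ B
  [cls0≡_] ∣B∩Δ′_∣ : Fin d → ℕ
  [cls0≡ i ] = ∣ ⌊ cls zero ≟ i ⌋ ∷ [] ∣
  ∣B∩Δ′ i ∣ = ∣ B ∩ classSet cls′ i ∣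
  split : ∀ i → ∣ (true ∷ B) ∩ classSet cls i ∣ ≡ [cls0≡ i ] + ∣B∩Δ′ i ∣
  split i = ∣x∷p∣≡∣x∷[]∣+∣p∣ ⌊ cls zero ≟ i ⌋ (B ∩ classSet cls′ i)

module _ {v d : ℕ} (cls : Fin v → Fin d) where

  ∈-classSet⇔ : ∀ {x i} → x ∈ classSet cls i ⇔ cls x ≡ i
  ∈-classSet⇔ {i = i} = ∈-tabulate⇔ (λ x → cls x ≟ i)

  ∈-classesMeeting⇔ : ∀ {B i} → i ∈ classesMeeting cls B ⇔ (∃[ x ] x ∈ B × cls x ≡ i)
  ∈-classesMeeting⇔ {B} = ∈-tabulate⇔ (λ i → any? (λ x → (x ∈? B) ×-dec (cls x ≟ i)))

  ∣classesMeeting∣*ℓ≡∣p∣ : ∀ {B ℓ} → (∀ i → ∣ B ∩ classSet cls i ∣ ≢ 0 → ∣ B ∩ classSet cls i ∣ ≡ ℓ) →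
    ∣ classesMeeting cls B ∣ * ℓ ≡ ∣ B ∣
  ∣classesMeeting∣*ℓ≡∣p∣ {B} {ℓ} constMeet = sym (trans (∣p∣≡∑∣p∩classSet∣ cls B)
    (∑-constOn (classesMeeting cls B) (λ i → ∣ B ∩ classSet cls i ∣) meets misses))
    where
    meets : ∀ {i} → i ∈ classesMeeting cls B → ∣ B ∩ classSet cls i ∣ ≡ ℓ
    meets {i} i∈𝒞B = let x , x∈B , x~i = to ∈-classesMeeting⇔ i∈𝒞B in
      constMeet i (x∈p⇒∣p∣≢0 (x∈p∩q⁺ (x∈B , from ∈-classSet⇔ x~i)))
    misses : ∀ {i} → i ∉ classesMeeting cls B → ∣ B ∩ classSet cls i ∣ ≡ 0
    misses {i} i∉𝒞B = trans (cong ∣_∣ (Empty-unique λ (x , x∈B∩Δ) →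
        let x∈B , x∈Δ = x∈p∩q⁻ B (classSet cls i) x∈B∩Δ in
        i∉𝒞B (from ∈-classesMeeting⇔ (x , x∈B , to ∈-classSet⇔ x∈Δ))))
      (∣⊥∣≡0 v)

  module _ {G : List (Perm v)} (G-group : PermGroup v G) (G-invariant : PreservesPartition cls G) where

    reflectsPartition : ∀ {g} → g ∈ₗ G → ∀ {x y} → cls (g · x) ≡ cls (g · y) → cls x ≡ cls y
    reflectsPartition {g} g∈G {x} {y} gx~gy with inverse G-group g∈G
    ... | g⁻¹ , g⁻¹∈G , _ , g⁻¹g≡1 = begin
      cls x                  ≡⟨ cong cls (∘ₚ≡idPerm⇒· g⁻¹ g g⁻¹g≡1 x) ⟨
      cls (g⁻¹ · (g · x))    ≡⟨ G-invariant g⁻¹∈G (g · x) (g · y) gx~gy ⟩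
      cls (g⁻¹ · (g · y))    ≡⟨ cong cls (∘ₚ≡idPerm⇒· g⁻¹ g g⁻¹g≡1 y) ⟩
      cls y                  ∎

    FixesSet-classSet : ∀ {g α} → g ∈ₗ G → g · α ≡ α → FixesSet g (classSet cls (cls α))
    FixesSet-classSet {g} {α} g∈G gα≡α x = mk⇔
      (λ x∈Δ → from ∈-classSet⇔ (trans (G-invariant g∈G x α (to ∈-classSet⇔ x∈Δ)) (cong cls gα≡α)))
      (λ gx∈Δ → from ∈-classSet⇔
         (reflectsPartition g∈G (trans (to ∈-classSet⇔ gx∈Δ) (cong cls (sym gα≡α)))))

    FixesClassSet-classesMeeting : ∀ {g B} → g ∈ₗ G → FixesSet g B → FixesClassSet cls g (classesMeeting cls B)
    FixesClassSet-classesMeeting {g} {B} g∈G g[B]≡B x = mk⇔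
      (λ [x]∈𝒞B → let y , y∈B , y~x = to ∈-classesMeeting⇔ [x]∈𝒞B in
         from ∈-classesMeeting⇔ (g · y , to (g[B]≡B y) y∈B , G-invariant g∈G y x y~x))
      (λ [gx]∈𝒞B → let y , y∈B , y~gx = to ∈-classesMeeting⇔ [gx]∈𝒞B in
         from ∈-classesMeeting⇔ (preimageWitness y∈B y~gx))
      where
      preimageWitness : ∀ {y} → y ∈ B → cls y ≡ cls (g · x) → ∃[ z ] z ∈ B × cls z ≡ cls x
      preimageWitness {y} y∈B y~gx with inverse G-group g∈G
      ... | g⁻¹ , _ , gg⁻¹≡1 , _ = g⁻¹ · y
        , from (g[B]≡B (g⁻¹ · y)) (subst (_∈ B) (sym (∘ₚ≡idPerm⇒· g g⁻¹ gg⁻¹≡1 y)) y∈B)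
        , reflectsPartition g∈G (trans (cong cls (∘ₚ≡idPerm⇒· g g⁻¹ gg⁻¹≡1 y)) y~gx)

module _ {v : ℕ} where

  -- Acting by preimages (a right action) makes "P fixes B" literally
  -- "preimage g B ≡ B", without appeal to bijectivity.
  preimage : Perm v → Subset v → Subset v
  preimage g B = tabulate (λ x → ⌊ g · x ∈? B ⌋)

  ∈-preimage⇔ : ∀ g B {x} → x ∈ preimage g B ⇔ g · x ∈ B
  ∈-preimage⇔ g B = ∈-tabulate⇔ (λ x → g · x ∈? B)

  preimage-∘ₚ : ∀ g h B → preimage (g ∘ₚ h) B ≡ preimage h (preimage g B)
  preimage-∘ₚ g h B = Subset-ext λ x → mk⇔
    (λ x∈ → from (∈-preimage⇔ h _) (from (∈-preimage⇔ g B)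
              (subst (_∈ B) (∘ₚ-· g h x) (to (∈-preimage⇔ (g ∘ₚ h) B) x∈))))
    (λ x∈ → from (∈-preimage⇔ (g ∘ₚ h) B)
              (subst (_∈ B) (sym (∘ₚ-· g h x)) (to (∈-preimage⇔ g B) (to (∈-preimage⇔ h _) x∈))))

  preimage-idPerm : ∀ B → preimage idPerm B ≡ B
  preimage-idPerm B = Subset-ext λ x → mk⇔
    (λ x∈ → subst (_∈ B) (idPerm-· x) (to (∈-preimage⇔ idPerm B) x∈))
    (λ x∈ → from (∈-preimage⇔ idPerm B) (subst (_∈ B) (sym (idPerm-· x)) x∈))

  preimage≡⇒FixesSet : ∀ {g B} → preimage g B ≡ B → FixesSet g B
  preimage≡⇒FixesSet {g} {B} g⁻¹B≡B x = mk⇔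
    (λ x∈B → to (∈-preimage⇔ g B) (subst (x ∈_) (sym g⁻¹B≡B) x∈B))
    (λ gx∈B → subst (x ∈_) g⁻¹B≡B (from (∈-preimage⇔ g B) gx∈B))

  MapsTo⇒≡preimage : ∀ {g h B B'} → (∀ x → h · (g · x) ≡ x) → MapsTo h B B' → B' ≡ preimage g B
  MapsTo⇒≡preimage {g} {h} {B} {B'} hg≗id h[B]≡B' = Subset-ext λ x → mk⇔
    (λ x∈B' → from (∈-preimage⇔ g B) (from (h[B]≡B' (g · x)) (subst (_∈ B') (sym (hg≗id x)) x∈B')))
    (λ x∈ → subst (_∈ B') (hg≗id x) (to (h[B]≡B' (g · x)) (to (∈-preimage⇔ g B) x∈)))

p∤d∣p^n⇒d≡1 : ∀ {p} → Prime p → ∀ n {d} → d ∣ p ^ n → ¬ p ∣ d → d ≡ 1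
p∤d∣p^n⇒d≡1 p-prime zero    d∣1    _   = ∣1⇒≡1 d∣1
p∤d∣p^n⇒d≡1 {p} p-prime (suc n) {d} d∣p^1+n p∤d =
  p∤d∣p^n⇒d≡1 p-prime n (coprime-divisor d⊥p d∣p^1+n) p∤d
  where
  d⊥p : Coprime d p
  d⊥p (e∣d , e∣p) with prime⇒irreducible p-prime e∣p
  ... | inj₁ e≡1 = e≡1
  ... | inj₂ refl = contradiction e∣d p∤d

module RightAction {v} {P : List (Perm v)} (P-group : PermGroup v P)
  {X : Set} (_≟_ : DecidableEquality X) (act : Perm v → X → X)
  (act-∘ₚ : ∀ g h x → act (g ∘ₚ h) x ≡ act h (act g x))
  (act-idPerm : ∀ x → act idPerm x ≡ x)
  where

  open PermGroup P-group

  Fixed : X → Set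
  Fixed x = ∀ {g} → g ∈ₗ P → act g x ≡ x

  Invariant : List X → Set
  Invariant ys = ∀ {g y} → g ∈ₗ P → y ∈ₗ ys → act g y ∈ₗ ys

  _↝_ : X → X → Set
  x ↝ y = Any (λ g → act g x ≡ y) P

  _↝?_ : ∀ x y → Dec (x ↝ y)
  x ↝? y = Any.any? (λ g → act g x ≟ y) P

  orbitIn : List X → X → List X
  orbitIn ys x = filter (x ↝?_) ys

  transporter : X → X → List (Perm v)
  transporter x y = fibre _≟_ (λ g → act g x) y P

  ↝-act : ∀ {g} x → g ∈ₗ P → x ↝ act g x
  ↝-act x g∈P = Any.map (λ { refl → refl }) g∈P

  ↝-refl : ∀ x → x ↝ x
  ↝-refl x = subst (x ↝_) (act-idPerm x) (↝-act x hasId)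

  ↝-act⁻ : ∀ {g x y} → g ∈ₗ P → x ↝ act g y → x ↝ y
  ↝-act⁻ {g} {x} {y} g∈P x↝gy with find x↝gy | inverse P-group g∈P
  ... | t , t∈P , tx≡gy | g⁻¹ , g⁻¹∈P , gg⁻¹≡1 , _ = Any.map (λ { refl → begin
    act (t ∘ₚ g⁻¹) x        ≡⟨ act-∘ₚ t g⁻¹ x ⟩
    act g⁻¹ (act t x)       ≡⟨ cong (act g⁻¹) tx≡gy ⟩
    act g⁻¹ (act g y)       ≡⟨ act-∘ₚ g g⁻¹ y ⟨
    act (g ∘ₚ g⁻¹) y        ≡⟨ cong (λ h → act h y) gg⁻¹≡1 ⟩
    act idPerm y            ≡⟨ act-idPerm y ⟩
    y                       ∎ }) (closed t∈P g⁻¹∈P)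

  length-transporter-≤ : ∀ {g} x y → g ∈ₗ P → length (transporter x y) ≤ length (transporter x (act g y))
  length-transporter-≤ {g} x y g∈P with inverse P-group g∈P
  ... | g⁻¹ , _ , gg⁻¹≡1 , _ =
    subst (_≤ length (transporter x (act g y))) (length-map (_∘ₚ g) (transporter x y))
      (Unique-⊆⇒length≤ _≟ₚ_ (Unique.map⁺ (∘ₚ-cancelʳ {g = g} {g⁻¹} gg⁻¹≡1) (Unique.filter⁺ _ unique)) tg∈)
    where
    tg∈ : ∀ {s} → s ∈ₗ map (_∘ₚ g) (transporter x y) → s ∈ₗ transporter x (act g y)
    tg∈ s∈ with ∈-map⁻ (_∘ₚ g) s∈
    ... | t , t∈ , refl with ∈-filter⁻ (λ t → act t x ≟ y) t∈
    ...   | t∈P , tx≡y = ∈-filter⁺ (λ s → act s x ≟ act g y) (closed t∈P g∈P)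
                           (trans (act-∘ₚ t g x) (cong (act g) tx≡y))

  length-transporter : ∀ {x y} → x ↝ y → length (transporter x y) ≡ length (transporter x x)
  length-transporter {x} x↝y with find x↝y
  ... | h , h∈P , refl with inverse P-group h∈P
  ...   | h⁻¹ , h⁻¹∈P , hh⁻¹≡1 , _ = ≤-antisym
    (subst (λ z → length (transporter x (act h x)) ≤ length (transporter x z)) hh⁻¹x≡x
      (length-transporter-≤ x (act h x) h⁻¹∈P))
    (length-transporter-≤ x x h∈P)
    where
    hh⁻¹x≡x : act h⁻¹ (act h x) ≡ x
    hh⁻¹x≡x = trans (sym (act-∘ₚ h h⁻¹ x)) (trans (cong (λ g → act g x) hh⁻¹≡1) (act-idPerm x))

  orbit-stabiliser : ∀ {ys x} → Unique ys → Invariant ys → x ∈ₗ ys →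
    length P ≡ length (orbitIn ys x) * length (transporter x x)
  orbit-stabiliser {ys} {x} ys! ys-inv x∈ys =
    length-by-fibres _≟_ (λ g → act g x) _ (Unique.filter⁺ (x ↝?_) ys!) P
      (λ g∈P → ∈-filter⁺ (x ↝?_) (ys-inv g∈P x∈ys) (↝-act x g∈P))
      (λ y∈orbit → length-transporter (proj₂ (∈-filter⁻ (x ↝?_) {xs = ys} y∈orbit)))

  length-orbit≡1⇒Fixed : ∀ {ys x} → Invariant ys → x ∈ₗ ys → length (orbitIn ys x) ≡ 1 → Fixed x
  length-orbit≡1⇒Fixed {ys} {x} ys-inv x∈ys |orbit|≡1 g∈P = length≡1⇒≡ |orbit|≡1
    (∈-filter⁺ (x ↝?_) (ys-inv g∈P x∈ys) (↝-act x g∈P)) (∈-filter⁺ (x ↝?_) x∈ys (↝-refl x))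

  Invariant-∖orbit : ∀ {ys} → Invariant ys → ∀ x → Invariant (filter (∁? (x ↝?_)) ys)
  Invariant-∖orbit {ys} ys-inv x g∈P y∈ with ∈-filter⁻ (∁? (x ↝?_)) {xs = ys} y∈
  ... | y∈ys , x↝̸y = ∈-filter⁺ (∁? (x ↝?_)) (ys-inv g∈P y∈ys) (λ x↝gy → x↝̸y (↝-act⁻ g∈P x↝gy))

  module PGroup {p n} (p-prime : Prime p) (|P|≡p^n : length P ≡ p ^ n) where

    p∤orbit⇒Fixed : ∀ {ys x} → Unique ys → Invariant ys → x ∈ₗ ys → ¬ p ∣ length (orbitIn ys x) → Fixed x
    p∤orbit⇒Fixed {ys} {x} ys! ys-inv x∈ys p∤orbit = length-orbit≡1⇒Fixed ys-inv x∈ys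
      (p∤d∣p^n⇒d≡1 p-prime n (divides (length (transporter x x)) orbit-stabiliser′) p∤orbit)
      where
      orbit-stabiliser′ : p ^ n ≡ length (transporter x x) * length (orbitIn ys x)
      orbit-stabiliser′ = trans (sym |P|≡p^n)
        (trans (orbit-stabiliser ys! ys-inv x∈ys) (*-comm (length (orbitIn ys x)) _))

    -- Either the orbit of the head y has length prime to p, so y is fixed, or
    -- its length is divisible by p and the complement of the orbit is shorter
    -- and still of length prime to p.
    p∤length⇒∃Fixed : ∀ {ys} → Unique ys → Invariant ys → ¬ p ∣ length ys → ∃[ y ] y ∈ₗ ys × Fixed y
    p∤length⇒∃Fixed {ys} = go ys (<-wellFounded (length ys))
      where
      go : ∀ ys → Acc _<_ (length ys) → Unique ys → Invariant ys → ¬ p ∣ length ys →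
           ∃[ y ] y ∈ₗ ys × Fixed y
      go [] _ _ _ p∤0 = contradiction (p ∣0) p∤0
      go ys@(y ∷ _) (acc smaller) ys! ys-inv p∤ys with p ∣? length (orbitIn ys y)
      ... | no p∤orbit = y , here refl , p∤orbit⇒Fixed ys! ys-inv (here refl) p∤orbit
      ... | yes p∣orbit
        with go rest (smaller rest<ys) (Unique.filter⁺ (∁? (y ↝?_)) ys!) (Invariant-∖orbit ys-inv y) p∤rest
        where
        rest : List X
        rest = filter (∁? (y ↝?_)) ys
        rest<ys : length rest < length ys
        rest<ys = filter-notAll (∁? (y ↝?_)) ys (here (λ y↝̸y → y↝̸y (↝-refl y)))
        p∤rest : ¬ p ∣ length rest
        p∤rest p∣rest = p∤ys (subst (p ∣_) (sym (length-filter+length-filter-∁ (y ↝?_) ys))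
                                         (∣m∣n⇒∣m+n p∣orbit p∣rest))
      ...   | z , z∈rest , z-fixed = z , proj₁ (∈-filter⁻ (∁? (y ↝?_)) {xs = ys} z∈rest) , z-fixed

    length<p⇒Fixed : ∀ {ys y} → Unique ys → Invariant ys → length ys < p → y ∈ₗ ys → Fixed y
    length<p⇒Fixed {ys} {y} ys! ys-inv ys<p y∈ys = p∤orbit⇒Fixed ys! ys-inv y∈ys p∤orbit
      where
      p∤orbit : ¬ p ∣ length (orbitIn ys y)
      -- matching the orbit against _ ∷ _ provides the NonZero instance for ∣⇒≤
      p∤orbit p∣orbit with orbitIn ys y | ∈-filter⁺ (y ↝?_) y∈ys (↝-refl y) | length-filter (y ↝?_) ys
      ... | _ ∷ _ | _ | orbit≤ys = <-irrefl refl (≤-<-trans (∣⇒≤ p∣orbit) (≤-<-trans orbit≤ys ys<p))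

blocksThrough : ∀ {v} → List (Subset v) → Fin v → Fin v → List (Subset v)
blocksThrough blocks α β = filter (λ B → (α ∈? B) ×-dec (β ∈? B)) blocks

∈-blocksThrough⇔ : ∀ {v} {blocks : List (Subset v)} {α β B} →
  B ∈ₗ blocksThrough blocks α β ⇔ (B ∈ₗ blocks × α ∈ B × β ∈ B)
∈-blocksThrough⇔ {blocks = blocks} {α} {β} = mk⇔
  (∈-filter⁻ (λ B → (α ∈? B) ×-dec (β ∈? B)) {xs = blocks})
  (λ (B∈ , α∈B×β∈B) → ∈-filter⁺ (λ B → (α ∈? B) ×-dec (β ∈? B)) B∈ α∈B×β∈B)

preimage-∈blocks : ∀ {v} {blocks : List (Subset v)} {g h B} → IsAutomorphism blocks h →
  (∀ x → h · (g · x) ≡ x) → B ∈ₗ blocks → preimage g B ∈ₗ blocks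
preimage-∈blocks {g = g} {h} (_ , h-maps) hg≗id B∈ with h-maps B∈
... | B' , B'∈ , h[B]≡B' = subst (_∈ₗ _) (MapsTo⇒≡preimage {g = g} {h} hg≗id h[B]≡B') B'∈

module BlockAction {v} {P : List (Perm v)} (P-group : PermGroup v P) where

  open RightAction P-group (≡-dec Bool._≟_) preimage preimage-∘ₚ preimage-idPerm public

  blocksThrough-invariant : ∀ {blocks α β} → (∀ {g} → g ∈ₗ P → IsAutomorphism blocks g) →
    (∀ {g} → g ∈ₗ P → g · α ≡ α) → (∀ {g} → g ∈ₗ P → g · β ≡ β) → Invariant (blocksThrough blocks α β)
  blocksThrough-invariant P-aut α-fixed β-fixed {g} {B} g∈P B∈through
    with to ∈-blocksThrough⇔ B∈through | inverse P-group g∈P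
  ... | B∈ , α∈B , β∈B | g⁻¹ , g⁻¹∈P , _ , g⁻¹g≡1 = from ∈-blocksThrough⇔
    ( preimage-∈blocks {g = g} {g⁻¹} (P-aut g⁻¹∈P) (∘ₚ≡idPerm⇒· g⁻¹ g g⁻¹g≡1) B∈
    , fixed∈preimage α-fixed α∈B , fixed∈preimage β-fixed β∈B)
    where
    fixed∈preimage : ∀ {x} → (∀ {g} → g ∈ₗ P → g · x ≡ x) → x ∈ B → x ∈ preimage g B
    fixed∈preimage x-fixed x∈B = from (∈-preimage⇔ g B) (subst (_∈ B) (sym (x-fixed g∈P)) x∈B)

  Fixed⇒FixesSet : ∀ {B} → Fixed B → ∀ {g} → g ∈ₗ P → FixesSet g B
  Fixed⇒FixesSet {B} B-fixed {g} g∈P = preimage≡⇒FixesSet {g = g} {B} (B-fixed g∈P)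

proposition2p5 :
    ∀ (v k lam d c ℓ : ℕ) (blocks : List (Subset v)) (G : List (Perm v))
      (cls : Fin v → Fin d) →
    HypothesisH v k lam d c ℓ blocks G cls →
    ∀ (p : ℕ) → Prime p → p ∣ length G → ¬ (p ∣ lam) →
    ∀ (P : List (Perm v)) → NontrivialPSubgroup p P G →
    ∀ (α β : Fin v) → α ≢ β →
    (∀ {g} → g ∈ₗ P → g · α ≡ α) → (∀ {g} → g ∈ₗ P → g · β ≡ β) →
    -- (a) with Δ = class of α
    (Σ (Subset v) λ B → B ∈ₗ blocks × α ∈ B × β ∈ B
       × (∀ {g} → g ∈ₗ P → FixesSet g B)
       × ∣ B ∩ classSet cls (cls α) ∣ ≡ ℓ
       × (∀ {g} → g ∈ₗ P → FixesSet g (B ∩ classSet cls (cls α)))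
       × ∣ classesMeeting cls B ∣ * ℓ ≡ k
       × (∀ {g} → g ∈ₗ P → FixesClassSet cls g (classesMeeting cls B)))
    ×
    -- (b)
    (lam < p → ∀ {B} → B ∈ₗ blocks → α ∈ B → β ∈ B →
       ∀ {g} → g ∈ₗ P → FixesSet g B)
proposition2p5 v k lam d c ℓ blocks G cls H p p-prime _ p∤lam P (P≤G , n , |P|≡p^1+n)
               α β α≢β α-fixed β-fixed =
  let B , B∈through , B-fixed =
        p∤length⇒∃Fixed through! through-invariant (p∤lam ∘ subst (p ∣_) |through|≡lam)
      B∈ , α∈B , β∈B = to ∈-blocksThrough⇔ B∈through
  in (B , B∈ , α∈B , β∈B , Fixed⇒FixesSet B-fixed
     , constMeet B∈ (cls α) (x∈p⇒∣p∣≢0 (x∈p∩q⁺ (α∈B , from (∈-classSet⇔ cls) refl)))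
     , (λ {g} g∈P → FixesSet-∩ {g = g} (Fixed⇒FixesSet B-fixed g∈P) (Δ-fixed g∈P))
     , trans (∣classesMeeting∣*ℓ≡∣p∣ cls (constMeet B∈)) (blockSize B∈)
     , (λ g∈P → FixesClassSet-classesMeeting cls P-group P-invariant g∈P (Fixed⇒FixesSet B-fixed g∈P)))
   , λ lam<p B∈ α∈B β∈B → Fixed⇒FixesSet (length<p⇒Fixed through! through-invariant
       (subst (_< p) (sym |through|≡lam) lam<p) (from ∈-blocksThrough⇔ (B∈ , α∈B , β∈B)))
  where
  open HypothesisH H
  open Design design
  open Subgroup P≤G renaming (isGroup to P-group; subset to P⊆G)
  open BlockAction P-group
  open PGroup {n = suc n} p-prime |P|≡p^1+n

  P-invariant : PreservesPartition cls P
  P-invariant = invariant ∘ P⊆G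

  Δ-fixed : ∀ {g} → g ∈ₗ P → FixesSet g (classSet cls (cls α))
  Δ-fixed g∈P = FixesSet-classSet cls P-group P-invariant g∈P (α-fixed g∈P)

  through : List (Subset v)
  through = blocksThrough blocks α β

  through! : Unique through
  through! = Unique.filter⁺ _ unique

  through-invariant : Invariant through
  through-invariant = blocksThrough-invariant (All.lookup automorphisms ∘ P⊆G) α-fixed β-fixed

  |through|≡lam : length through ≡ lam
  |through|≡lam = balanced α β α≢β
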